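{- Let $p\geq 3$ be odd, let $G=(V,E)$ be a $(p,2)$-flex-connected graph, and let $A,B\subseteq V$ be two violated sets that cross. Let $\alpha=(p+1)/2$. Then $E(A\cap B, V\setminus(A\cup B))=\emptyset$ and $E(A\setminus B, B\setminus A)=\emptyset$. Moreover, consider the four edge sets $E(A\setminus B, A\cap B)$, $E(A\cap B, B\setminus A)$, $E(B\setminus A, V\setminus(A\cup B))$, $E(V\setminus(A\cup B), A\setminus B)$, arranged in this cyclic order (consecutive ones share a common vertex class). Then two of them that share a common vertex class each have exactly $\alpha$ edges and each contains at most one unsafe edge, and the other two each have exactly $\alpha+1$ edges.
   Context: $G=(V,E)$ is a finite graph (parallel edges allowed) whose edge set is partitioned into safe and unsafe edges; $\mathcal{U}$ is the set of unsafe edges. For $S\subseteq V$, $\delta(S)$ is the set of edges with exactly one endpoint in $S$; for disjoint $X,Y\subseteq V$, $E(X,Y)$ is the set of edges with one endpoint in $X$ and the other in $Y$. $G$ is $(p,2)$-flex-connected if for every $F\subseteq\mathcal{U}$ with $|F|\leq 2$ the graph $(V,E\setminus F)$ is $p$-edge-connected. A set $S\subseteq V$ is violated if $|\delta(S)|=p+2$ and $\delta(S)$ contains at least $3$ unsafe edges. Two sets $A,B\subseteq V$ cross if $A\setminus B$, $A\cap B$, $B\setminus A$, $V\setminus(A\cup B)$ are all nonempty. -}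

module Defs where

open import Data.Nat using (ℕ; zero; suc; _+_; _≤_)
open import Data.Nat.DivMod using (_/_; _%_)
open import Data.Bool using (Bool; true; false; _∧_; _∨_; _xor_; not; if_then_else_; T)
open import Data.Fin using (Fin; zero; suc)
open import Data.Product using (_×_; _,_; proj₁; proj₂; ∃)
open import Data.Sum using (_⊎_)
open import Relation.Binary.PropositionalEquality using (_≡_)
open import Relation.Nullary using (¬_)

-- A finite multigraph: vertices Fin nV, edges Fin nE (parallel edges allowed,
-- each edge has its own index), each edge is safe or unsafe.
record Graph : Set where
  field
    nV       : ℕ
    nE       : ℕ
    ends     : Fin nE → Fin nV × Fin nV
    unsafeFlag : Fin nE → Bool
open Graph public

VSet : Graph → Set
VSet G = Fin (nV G) → Bool

ESet : Graph → Set
ESet G = Fin (nE G) → Bool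

count : {k : ℕ} → (Fin k → Bool) → ℕ
count {zero}  P = 0
count {suc k} P = (if P zero then 1 else 0) + count (λ i → P (suc i))

_∩ᵥ_ : {k : ℕ} → (Fin k → Bool) → (Fin k → Bool) → (Fin k → Bool)
(X ∩ᵥ Y) v = X v ∧ Y v

_∪ᵥ_ : {k : ℕ} → (Fin k → Bool) → (Fin k → Bool) → (Fin k → Bool)
(X ∪ᵥ Y) v = X v ∨ Y v

_∖ᵥ_ : {k : ℕ} → (Fin k → Bool) → (Fin k → Bool) → (Fin k → Bool)
(X ∖ᵥ Y) v = X v ∧ not (Y v)

compl : {k : ℕ} → (Fin k → Bool) → (Fin k → Bool)
compl X v = not (X v)

Nonempty : {G : Graph} → VSet G → Set
Nonempty {G} X = ∃ λ (v : Fin (nV G)) → T (X v)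

δ : (G : Graph) → VSet G → ESet G
δ G S e = S (proj₁ (ends G e)) xor S (proj₂ (ends G e))

Eb : (G : Graph) → VSet G → VSet G → ESet G
Eb G X Y e = (X u ∧ Y w) ∨ (Y u ∧ X w)
  where
  u = proj₁ (ends G e)
  w = proj₂ (ends G e)

𝒰 : (G : Graph) → ESet G
𝒰 G = unsafeFlag G

_∩ₑ_ : {k : ℕ} → (Fin k → Bool) → (Fin k → Bool) → (Fin k → Bool)
(F ∩ₑ K) e = F e ∧ K e

_⊆ₑ_ : {G : Graph} → ESet G → ESet G → Set
_⊆ₑ_ {G} F K = (e : Fin (nE G)) → T (F e) → T (K e)

EdgeConnected : (G : Graph) → ESet G → ℕ → Set
EdgeConnected G K p =
  (S : VSet G) → Nonempty {G} S → Nonempty {G} (compl S) →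
  p ≤ count (δ G S ∩ₑ K)

FlexConnected : ℕ → Graph → Set
FlexConnected p G =
  (F : ESet G) → _⊆ₑ_ {G} F (𝒰 G) → count F ≤ 2 →
  EdgeConnected G (λ e → not (F e)) p

Violated : (p : ℕ) (G : Graph) → VSet G → Set
Violated p G S =
  count (δ G S) ≡ p + 2 × 3 ≤ count (δ G S ∩ₑ 𝒰 G)

Cross : (G : Graph) → VSet G → VSet G → Set
Cross G A B =
  Nonempty {G} (A ∖ᵥ B) × Nonempty {G} (A ∩ᵥ B) ×
  Nonempty {G} (B ∖ᵥ A) × Nonempty {G} (compl (A ∪ᵥ B))

Empty : (G : Graph) → ESet G → Set
Empty G F = (e : Fin (nE G)) → ¬ T (F e)

Pattern : (G : Graph) → ℕ → ESet G → ESet G → ESet G → ESet G → Set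
Pattern G α X₁ X₂ X₃ X₄ =
  count X₁ ≡ α × count X₂ ≡ α ×
  count (X₁ ∩ₑ 𝒰 G) ≤ 1 × count (X₂ ∩ₑ 𝒰 G) ≤ 1 ×
  count X₃ ≡ α + 1 × count X₄ ≡ α + 1

module Submission where

-- Let X = A ∖ B, Y = A ∩ B, Z = B ∖ A, W = V ∖ (A ∪ B), arranged around a square in this order.
-- Each region is a nonempty proper vertex set, so by flex-connectivity its cut has p + s edges,
-- where the slack s is at least the number of unsafe edges in that cut, capped at 2.  Sorting the
-- edges of δ(A) and δ(B) by the regions of their ends shows that the slacks of two opposite regions
-- plus twice the diagonal between the other two sum to 4, and that the slacks of two adjacent regions
-- sum to twice the side between them plus 2 − p, an odd number.  Two adjacent regions together form
-- A, B or the complement of one of them, so their cuts contain at least 3 unsafe edges; and the cuts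
-- of two opposite regions together with the other diagonal counted twice contain the at least 6
-- unsafe edges of δ(A) and δ(B).  Hence at most one region has slack at most 1, parity forces the
-- slacks 1, 2, 3, 2 around the square and empty diagonals, and these slacks determine the sides.

open import Defs
open import Data.Nat using (ℕ; _≤_; _+_)
open import Data.Nat.DivMod using (_/_; _%_)
open import Data.Product using (_×_)
open import Data.Sum using (_⊎_)
open import Relation.Binary.PropositionalEquality using (_≡_)

open import Data.Bool using (Bool; true; false; _∧_; _∨_; not; T; if_then_else_)
open import Data.Bool.Properties using (T-∧; ∧-identityʳ; ∧-zeroʳ)
open import Data.Empty using (⊥; ⊥-elim)
open import Data.Fin using (Fin; zero; suc)
open import Data.List using ([]; _∷_)
open import Data.Nat using (zero; suc; _*_; _∸_; _⊓_; _≡ᵇ_; _≤?_; z≤n; s≤s; s≤s⁻¹)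
open import Data.Nat.DivMod using (m≡m%n+[m/n]*n; m*n/n≡m)
open import Data.Nat.Properties
open import Algebra.Properties.CommutativeSemigroup +-commutativeSemigroup using (interchange)
open import Data.Nat.Tactic.RingSolver using (solve-∀; solve)
open import Data.Product using (∃; _,_; proj₁; proj₂)
open import Data.Sum using (inj₁; inj₂)
open import Data.Unit using (tt)
open import Data.Vec.Functional using () renaming (_∷_ to _◂_)
open import Function using (_∘_; Equivalence)
open import Relation.Binary.PropositionalEquality
  using (_≢_; refl; sym; trans; cong; cong₂; subst; subst₂; module ≡-Reasoning)
open import Relation.Nullary using (¬_; yes; no; contradiction)

⟦_⟧ : Bool → ℕ
⟦ b ⟧ = if b then 1 else 0

interchange₃ : ∀ a b c x y z → a + b + c + (x + y + z) ≡ (a + x) + (b + y) + (c + z)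
interchange₃ = solve-∀

interchange₄ : ∀ a b c d x y z w →
  a + b + c + d + (x + y + z + w) ≡ (a + x) + (b + y) + (c + z) + (d + w)
interchange₄ = solve-∀

count-split₂ : ∀ {k} {P Q R : Fin k → Bool} →
  (∀ i → ⟦ P i ⟧ ≡ ⟦ Q i ⟧ + ⟦ R i ⟧) → count P ≡ count Q + count R
count-split₂ {zero}  _ = refl
count-split₂ {suc k} {P} {Q} {R} h =
  trans (cong₂ _+_ (h zero) (count-split₂ {P = P ∘ suc} {Q ∘ suc} {R ∘ suc} (h ∘ suc)))
    (interchange ⟦ Q zero ⟧ ⟦ R zero ⟧ (count (Q ∘ suc)) (count (R ∘ suc)))

count-split₃ : ∀ {k} {P Q R S : Fin k → Bool} →
  (∀ i → ⟦ P i ⟧ ≡ ⟦ Q i ⟧ + ⟦ R i ⟧ + ⟦ S i ⟧) → count P ≡ count Q + count R + count S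
count-split₃ {zero}  _ = refl
count-split₃ {suc k} {P} {Q} {R} {S} h =
  trans (cong₂ _+_ (h zero) (count-split₃ {P = P ∘ suc} {Q ∘ suc} {R ∘ suc} {S ∘ suc} (h ∘ suc)))
    (interchange₃ ⟦ Q zero ⟧ ⟦ R zero ⟧ ⟦ S zero ⟧ (count (Q ∘ suc)) (count (R ∘ suc)) (count (S ∘ suc)))

count-split₄ : ∀ {k} {P Q R S U : Fin k → Bool} →
  (∀ i → ⟦ P i ⟧ ≡ ⟦ Q i ⟧ + ⟦ R i ⟧ + ⟦ S i ⟧ + ⟦ U i ⟧) →
  count P ≡ count Q + count R + count S + count U
count-split₄ {zero}  _ = refl
count-split₄ {suc k} {P} {Q} {R} {S} {U} h =
  trans (cong₂ _+_ (h zero)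
           (count-split₄ {P = P ∘ suc} {Q ∘ suc} {R ∘ suc} {S ∘ suc} {U ∘ suc} (h ∘ suc)))
    (interchange₄ ⟦ Q zero ⟧ ⟦ R zero ⟧ ⟦ S zero ⟧ ⟦ U zero ⟧
                  (count (Q ∘ suc)) (count (R ∘ suc)) (count (S ∘ suc)) (count (U ∘ suc)))

restrict₃ : ∀ p q r s k → ⟦ p ⟧ ≡ ⟦ q ⟧ + ⟦ r ⟧ + ⟦ s ⟧ →
  ⟦ p ∧ k ⟧ ≡ ⟦ q ∧ k ⟧ + ⟦ r ∧ k ⟧ + ⟦ s ∧ k ⟧
restrict₃ p q r s true h
  rewrite ∧-identityʳ p | ∧-identityʳ q | ∧-identityʳ r | ∧-identityʳ s = h
restrict₃ p q r s false _
  rewrite ∧-zeroʳ p | ∧-zeroʳ q | ∧-zeroʳ r | ∧-zeroʳ s = refl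

restrict₄ : ∀ p q r s u k → ⟦ p ⟧ ≡ ⟦ q ⟧ + ⟦ r ⟧ + ⟦ s ⟧ + ⟦ u ⟧ →
  ⟦ p ∧ k ⟧ ≡ ⟦ q ∧ k ⟧ + ⟦ r ∧ k ⟧ + ⟦ s ∧ k ⟧ + ⟦ u ∧ k ⟧
restrict₄ p q r s u true h
  rewrite ∧-identityʳ p | ∧-identityʳ q | ∧-identityʳ r | ∧-identityʳ s | ∧-identityʳ u = h
restrict₄ p q r s u false _
  rewrite ∧-zeroʳ p | ∧-zeroʳ q | ∧-zeroʳ r | ∧-zeroʳ s | ∧-zeroʳ u = refl

count-split₃-∩ : ∀ {k} {P Q R S : Fin k → Bool} →
  (∀ i → ⟦ P i ⟧ ≡ ⟦ Q i ⟧ + ⟦ R i ⟧ + ⟦ S i ⟧) →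
  ∀ K → count (P ∩ₑ K) ≡ count (Q ∩ₑ K) + count (R ∩ₑ K) + count (S ∩ₑ K)
count-split₃-∩ {P = P} {Q} {R} {S} h K =
  count-split₃ λ i → restrict₃ (P i) (Q i) (R i) (S i) (K i) (h i)

count-split₄-∩ : ∀ {k} {P Q R S U : Fin k → Bool} →
  (∀ i → ⟦ P i ⟧ ≡ ⟦ Q i ⟧ + ⟦ R i ⟧ + ⟦ S i ⟧ + ⟦ U i ⟧) →
  ∀ K → count (P ∩ₑ K) ≡ count (Q ∩ₑ K) + count (R ∩ₑ K) + count (S ∩ₑ K) + count (U ∩ₑ K)
count-split₄-∩ {P = P} {Q} {R} {S} {U} h K =
  count-split₄ λ i → restrict₄ (P i) (Q i) (R i) (S i) (U i) (K i) (h i)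

count-∩-≤ : ∀ {k} (P K : Fin k → Bool) → count (P ∩ₑ K) ≤ count P
count-∩-≤ {zero}  _ _ = z≤n
count-∩-≤ {suc k} P K = +-mono-≤ (⟦∧⟧≤ (P zero) (K zero)) (count-∩-≤ (P ∘ suc) (K ∘ suc))
  where
  ⟦∧⟧≤ : ∀ x y → ⟦ x ∧ y ⟧ ≤ ⟦ x ⟧
  ⟦∧⟧≤ true  true  = ≤-refl
  ⟦∧⟧≤ true  false = z≤n
  ⟦∧⟧≤ false _     = z≤n

count≡0⇒¬T : ∀ {k} (P : Fin k → Bool) → count P ≡ 0 → ∀ i → ¬ T (P i)
count≡0⇒¬T {suc k} P eq zero    = ⟦⟧≡0⇒¬T (P zero) (m+n≡0⇒m≡0 ⟦ P zero ⟧ eq)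
  where
  ⟦⟧≡0⇒¬T : ∀ x → ⟦ x ⟧ ≡ 0 → ¬ T x
  ⟦⟧≡0⇒¬T false _ ()
count≡0⇒¬T {suc k} P eq (suc i) = count≡0⇒¬T (P ∘ suc) (m+n≡0⇒n≡0 ⟦ P zero ⟧ eq) i

subset-of-size : ∀ {k} (P : Fin k → Bool) {n} → n ≤ count P →
  ∃ λ (Q : Fin k → Bool) → (∀ i → T (Q i) → T (P i)) × count Q ≡ n
subset-of-size {zero}  P z≤n = P , (λ _ t → t) , refl
subset-of-size {suc k} P {n} n≤|P| with P zero in P₀ | n | n≤|P|
... | false | _     | n≤ = let Q , Q⊆P , |Q| = subset-of-size (P ∘ suc) n≤ in
  (false ◂ Q) , (λ { (suc i) → Q⊆P i }) , |Q|
... | true  | zero  | _  = let Q , Q⊆P , |Q| = subset-of-size (P ∘ suc) z≤n in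
  (false ◂ Q) , (λ { (suc i) → Q⊆P i }) , |Q|
... | true  | suc m | n≤ = let Q , Q⊆P , |Q| = subset-of-size (P ∘ suc) (s≤s⁻¹ n≤) in
  (true ◂ Q) , (λ { zero _ → subst T (sym P₀) tt ; (suc i) → Q⊆P i }) , cong suc |Q|

indicator-split : ∀ {x y} → (T y → T x) → ⟦ x ⟧ ≡ ⟦ x ∧ not y ⟧ + ⟦ y ⟧
indicator-split {true}  {true}  _ = refl
indicator-split {true}  {false} _ = refl
indicator-split {false} {true}  y⇒x = contradiction (y⇒x tt) λ ()
indicator-split {false} {false} _ = refl

all? : (Bool → Bool) → Bool
all? P = P false ∧ P true

all?-sound : ∀ P → T (all? P) → ∀ b → T (P b)
all?-sound P h false = proj₁ (Equivalence.to T-∧ h)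
all?-sound P h true  = proj₂ (Equivalence.to T-∧ h)

all⁴? : (Bool → Bool → Bool → Bool → Bool) → Bool
all⁴? P = all? λ x → all? λ y → all? λ z → all? (P x y z)

all⁴?-sound : ∀ P → T (all⁴? P) → ∀ x y z w → T (P x y z w)
all⁴?-sound P h x y z =
  all?-sound (P x y z) (all?-sound (λ z → all? (P x y z)) (all?-sound (λ y → all? λ z → all? (P x y z))
    (all?-sound (λ x → all? λ y → all? λ z → all? (P x y z)) h x) y) z)

edge : Graph
edge = record { nV = 2 ; nE = 1 ; ends = λ _ → zero , suc zero ; unsafeFlag = λ _ → false }

endpoints : Bool → Bool → VSet edge
endpoints x z = x ◂ z ◂ λ ()

EdgeCount : Set
EdgeCount = (G : Graph) → VSet G → VSet G → Fin (nE G) → ℕ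

-- An edge count that is Local only sees whether the two ends of the edge lie in A and in B, so it
-- agrees with its value on a single edge placed the same way; identities between such counts are
-- therefore decided by evaluating them in the 16 possible placements.  For every count built from
-- the operations of Defs, locality holds by refl.
Local : EdgeCount → Set
Local L = ∀ G A B i → L G A B i ≡ L edge
  (endpoints (A (proj₁ (ends G i))) (A (proj₂ (ends G i))))
  (endpoints (B (proj₁ (ends G i))) (B (proj₂ (ends G i)))) zero

agree-on-edge : EdgeCount → EdgeCount → Bool → Bool → Bool → Bool → Bool
agree-on-edge L R x y z w =
  L edge (endpoints x z) (endpoints y w) zero ≡ᵇ R edge (endpoints x z) (endpoints y w) zero

by-evaluation : {L R : EdgeCount} → Local L → Local R → T (all⁴? (agree-on-edge L R)) →
  ∀ G A B i → L G A B i ≡ R G A B i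
by-evaluation {L} {R} local-L local-R checked G A B i = begin
  L G A B i                                   ≡⟨ local-L G A B i ⟩
  L edge (endpoints x z) (endpoints y w) zero ≡⟨ ≡ᵇ⇒≡ _ _ (all⁴?-sound (agree-on-edge L R) checked x y z w) ⟩
  R edge (endpoints x z) (endpoints y w) zero ≡⟨ sym (local-R G A B i) ⟩
  R G A B i                                   ∎
  where
  open ≡-Reasoning
  x y z w : Bool
  x = A (proj₁ (ends G i))
  y = B (proj₁ (ends G i))
  z = A (proj₂ (ends G i))
  w = B (proj₂ (ends G i))

module Regions (G : Graph) (A B : VSet G) where
  X Y Z W : VSet G
  X = A ∖ᵥ B
  Y = A ∩ᵥ B
  Z = B ∖ᵥ A
  W = compl (A ∪ᵥ B)

δ-split-Y : ∀ G (A B : VSet G) i → let open Regions G A B in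
  ⟦ δ G Y i ⟧ ≡ ⟦ Eb G X Y i ⟧ + ⟦ Eb G Y Z i ⟧ + ⟦ Eb G Y W i ⟧
δ-split-Y = by-evaluation (λ _ _ _ _ → refl) (λ _ _ _ _ → refl) tt

δ-split-Z : ∀ G (A B : VSet G) i → let open Regions G A B in
  ⟦ δ G Z i ⟧ ≡ ⟦ Eb G Y Z i ⟧ + ⟦ Eb G Z W i ⟧ + ⟦ Eb G X Z i ⟧
δ-split-Z = by-evaluation (λ _ _ _ _ → refl) (λ _ _ _ _ → refl) tt

δ-split-W : ∀ G (A B : VSet G) i → let open Regions G A B in
  ⟦ δ G W i ⟧ ≡ ⟦ Eb G Z W i ⟧ + ⟦ Eb G W X i ⟧ + ⟦ Eb G Y W i ⟧
δ-split-W = by-evaluation (λ _ _ _ _ → refl) (λ _ _ _ _ → refl) tt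

δ-split-X : ∀ G (A B : VSet G) i → let open Regions G A B in
  ⟦ δ G X i ⟧ ≡ ⟦ Eb G W X i ⟧ + ⟦ Eb G X Y i ⟧ + ⟦ Eb G X Z i ⟧
δ-split-X = by-evaluation (λ _ _ _ _ → refl) (λ _ _ _ _ → refl) tt

δ-split-A : ∀ G (A B : VSet G) i → let open Regions G A B in
  ⟦ δ G A i ⟧ ≡ ⟦ Eb G Y Z i ⟧ + ⟦ Eb G W X i ⟧ + ⟦ Eb G Y W i ⟧ + ⟦ Eb G X Z i ⟧
δ-split-A = by-evaluation (λ _ _ _ _ → refl) (λ _ _ _ _ → refl) tt

δ-split-B : ∀ G (A B : VSet G) i → let open Regions G A B in
  ⟦ δ G B i ⟧ ≡ ⟦ Eb G Z W i ⟧ + ⟦ Eb G X Y i ⟧ + ⟦ Eb G X Z i ⟧ + ⟦ Eb G Y W i ⟧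
δ-split-B = by-evaluation (λ _ _ _ _ → refl) (λ _ _ _ _ → refl) tt

cut-lower-bound : ∀ {p G} → FlexConnected p G →
  (S : VSet G) → Nonempty {G} S → Nonempty {G} (compl S) →
  p + 2 ⊓ count (δ G S ∩ₑ 𝒰 G) ≤ count (δ G S)
cut-lower-bound {p} {G} flex S nonempty nonempty-compl
  with F , F⊆δS∩𝒰 , |F| ← subset-of-size (δ G S ∩ₑ 𝒰 G) (m⊓n≤n 2 _) = begin
  p + 2 ⊓ count (δ G S ∩ₑ 𝒰 G)                    ≡⟨ cong (p +_) (sym |F|) ⟩
  p + count F                                      ≤⟨ +-monoˡ-≤ (count F) connected ⟩
  count (δ G S ∩ₑ (λ e → not (F e))) + count F      ≡⟨ sym (count-split₂ λ i → indicator-split (F⊆δS i)) ⟩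
  count (δ G S) ∎
  where
  open ≤-Reasoning
  F⊆δS : ∀ i → T (F i) → T (δ G S i)
  F⊆δS i = proj₁ ∘ Equivalence.to T-∧ ∘ F⊆δS∩𝒰 i
  F⊆𝒰 : ∀ i → T (F i) → T (𝒰 G i)
  F⊆𝒰 i = proj₂ ∘ Equivalence.to T-∧ ∘ F⊆δS∩𝒰 i
  connected : p ≤ count (δ G S ∩ₑ (λ e → not (F e)))
  connected = flex F F⊆𝒰 (≤-trans (≤-reflexive |F|) (m⊓n≤m 2 _)) S nonempty nonempty-compl

odd≢even : ∀ m n → suc (m * 2) ≢ n * 2
odd≢even m n eq = even≢odd n m (trans (*-comm 2 n) (trans (sym eq) (cong suc (*-comm m 2))))

-- σ + p ≡ 2 + n * 2 relates a side with n edges to the sum σ of the slacks at its two ends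
-- (adjacent-slacks below), and p = 2q + 1.
slack-sum≢2 : ∀ {p q σ n} → p ≡ suc (q * 2) → σ + p ≡ 2 + n * 2 → σ ≢ 2
slack-sum≢2 {q = q} {n = n} refl eq refl = odd≢even q n (suc-injective (suc-injective eq))

slack-sum≢4 : ∀ {p q σ n} → p ≡ suc (q * 2) → σ + p ≡ 2 + n * 2 → σ ≢ 4
slack-sum≢4 {q = q} {n = n} refl eq refl = odd≢even (suc q) n (suc-injective (suc-injective eq))

side-length-3 : ∀ {p q σ n} → p ≡ suc (q * 2) → σ + p ≡ 2 + n * 2 → σ ≡ 3 → n ≡ suc q
side-length-3 {q = q} {n = n} refl eq refl =
  sym (*-cancelʳ-≡ (suc q) n 2 (suc-injective (suc-injective eq)))

side-length-5 : ∀ {p q σ n} → p ≡ suc (q * 2) → σ + p ≡ 2 + n * 2 → σ ≡ 5 → n ≡ suc q + 1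
side-length-5 {q = q} {n = n} refl eq refl =
  sym (trans (+-comm (suc q) 1) (*-cancelʳ-≡ (suc (suc q)) n 2 (suc-injective (suc-injective eq))))

both-large : ∀ {s t g} → 2 ≤ s → 2 ≤ t → s + t + g * 2 ≡ 4 → s ≡ 2 × t ≡ 2 × g ≡ 0
both-large {2} {2} {0} _ _ _ = refl , refl , refl
both-large {2} {2} {suc _} _ _ ()
both-large {2} {suc (suc (suc _))} _ _ ()
both-large {3} {suc (suc _)} _ _ ()
both-large {4} {suc (suc _)} _ _ ()
both-large {suc (suc (suc (suc (suc _))))} _ _ ()
both-large {1} (s≤s ()) _ _
both-large {_} {1} _ (s≤s ()) _

one-and-large : ∀ {s t g} → s ≡ 1 → 2 ≤ t → s + t + g * 2 ≡ 4 → t ≡ 3 × g ≡ 0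
one-and-large {t = 3} {0} refl _ _ = refl , refl
one-and-large {t = 2} {0} refl _ ()
one-and-large {t = 2} {suc _} refl _ ()
one-and-large {t = 3} {suc _} refl _ ()
one-and-large {t = suc (suc (suc (suc _)))} refl _ ()
one-and-large {t = 1} refl (s≤s ()) _

2⊓u≤s≤1⇒u≤s : ∀ {u s} → 2 ⊓ u ≤ s → s ≤ 1 → u ≤ s
2⊓u≤s≤1⇒u≤s {zero}        _ _   = z≤n
2⊓u≤s≤1⇒u≤s {suc zero}    h _   = h
2⊓u≤s≤1⇒u≤s {suc (suc _)} h s≤1 = contradiction (≤-trans h s≤1) 1+n≰n

excess : ∀ {p m n} → p + m ≤ n → n ≡ p + (n ∸ p) × m ≤ n ∸ p
excess {p} {m} {n} p+m≤n = sym n≡ , +-cancelˡ-≤ p m (n ∸ p) (subst (p + m ≤_) (sym n≡) p+m≤n)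
  where
  n≡ : p + (n ∸ p) ≡ n
  n≡ = m+[n∸m]≡n (≤-trans (m≤m+n p m) p+m≤n)

opposite-slack-sum : ∀ {p a b c d e f s t} → b + d + e + f ≡ p + 2 → c + a + f + e ≡ p + 2 →
  a + b + e ≡ p + s → c + d + e ≡ p + t → s + t + f * 2 ≡ 4
opposite-slack-sum {p} {a} {b} {c} {d} {e} {f} {s} {t} cut-A cut-B cut-Y cut-W =
  +-cancelˡ-≡ (p + p) _ _ (begin
    p + p + (s + t + f * 2)           ≡⟨ solve (p ∷ s ∷ t ∷ f ∷ []) ⟩
    (p + s) + (p + t) + f * 2         ≡⟨ cong₂ (λ x y → x + y + f * 2) (sym cut-Y) (sym cut-W) ⟩
    (a + b + e) + (c + d + e) + f * 2 ≡⟨ solve (a ∷ b ∷ c ∷ d ∷ e ∷ f ∷ []) ⟩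
    (b + d + e + f) + (c + a + f + e) ≡⟨ cong₂ _+_ cut-A cut-B ⟩
    (p + 2) + (p + 2)                 ≡⟨ solve (p ∷ []) ⟩
    p + p + 4                         ∎)
  where open ≡-Reasoning

adjacent-slack-sum : ∀ {p a b d e f s t} → b + d + e + f ≡ p + 2 →
  d + a + f ≡ p + s → a + b + e ≡ p + t → s + t + p ≡ 2 + a * 2
adjacent-slack-sum {p} {a} {b} {d} {e} {f} {s} {t} cut-A cut-X cut-Y =
  +-cancelˡ-≡ p _ _ (begin
    p + (s + t + p)           ≡⟨ solve (p ∷ s ∷ t ∷ []) ⟩
    (p + s) + (p + t)         ≡⟨ cong₂ _+_ (sym cut-X) (sym cut-Y) ⟩
    (d + a + f) + (a + b + e) ≡⟨ solve (a ∷ b ∷ d ∷ e ∷ f ∷ []) ⟩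
    a * 2 + (b + d + e + f)   ≡⟨ cong (a * 2 +_) cut-A ⟩
    a * 2 + (p + 2)           ≡⟨ solve (a ∷ p ∷ []) ⟩
    p + (2 + a * 2)           ∎)
  where open ≡-Reasoning

adjacent-unsafe-sum : ∀ {ua ub ud ue uf s t} → 3 ≤ ub + ud + ue + uf →
  ud + ua + uf ≤ s → ua + ub + ue ≤ t → 3 ≤ s + t
adjacent-unsafe-sum {ua} {ub} {ud} {ue} {uf} {s} {t} unsafe-A uX≤s uY≤t = begin
  3                             ≤⟨ unsafe-A ⟩
  ub + ud + ue + uf             ≤⟨ m≤n+m _ (ua + ua) ⟩
  ua + ua + (ub + ud + ue + uf) ≡⟨ solve (ua ∷ ub ∷ ud ∷ ue ∷ uf ∷ []) ⟩
  (ud + ua + uf) + (ua + ub + ue) ≤⟨ +-mono-≤ uX≤s uY≤t ⟩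
  s + t                         ∎
  where open ≤-Reasoning

opposite-unsafe-sum : ∀ {ua ub uc ud ue uf f s t} →
  3 ≤ ub + ud + ue + uf → 3 ≤ uc + ua + uf + ue →
  ua + ub + ue ≤ s → uc + ud + ue ≤ t → uf ≤ f → 6 ≤ s + t + f * 2
opposite-unsafe-sum {ua} {ub} {uc} {ud} {ue} {uf} {f} {s} {t} unsafe-A unsafe-B uY≤s uW≤t uf≤f = begin
  6                                         ≤⟨ +-mono-≤ unsafe-A unsafe-B ⟩
  (ub + ud + ue + uf) + (uc + ua + uf + ue) ≡⟨ solve (ua ∷ ub ∷ uc ∷ ud ∷ ue ∷ uf ∷ []) ⟩
  (ua + ub + ue) + (uc + ud + ue) + uf * 2  ≤⟨ +-mono-≤ (+-mono-≤ uY≤s uW≤t) (*-monoˡ-≤ 2 uf≤f) ⟩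
  s + t + f * 2                             ∎
  where open ≤-Reasoning

-- The counts attached to two crossing sets A, B (see crossing-counts below): a, b, c, d are the
-- numbers of edges of the sides E(X,Y), E(Y,Z), E(Z,W), E(W,X) of the square of regions, e and f
-- of its diagonals E(Y,W), E(X,Z), and ua, …, uf the numbers of unsafe edges among them.
record CrossingCounts (p : ℕ) : Set where
  field
    a b c d e f       : ℕ
    ua ub uc ud ue uf : ℕ
    cut-A    : b + d + e + f ≡ p + 2
    cut-B    : c + a + f + e ≡ p + 2
    unsafe-A : 3 ≤ ub + ud + ue + uf
    unsafe-B : 3 ≤ uc + ua + uf + ue
    ue≤e     : ue ≤ e
    uf≤f     : uf ≤ f
    corner-Y : p + 2 ⊓ (ua + ub + ue) ≤ a + b + e
    corner-Z : p + 2 ⊓ (ub + uc + uf) ≤ b + c + f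
    corner-W : p + 2 ⊓ (uc + ud + ue) ≤ c + d + e
    corner-X : p + 2 ⊓ (ud + ua + uf) ≤ d + a + f

-- The quarter turn of the square: the regions Y, Z, W, X take the places of X, Y, Z, W.
rotate : ∀ {p} → CrossingCounts p → CrossingCounts p
rotate r = record
  { a = b ; b = c ; c = d ; d = a ; e = f ; f = e
  ; ua = ub ; ub = uc ; uc = ud ; ud = ua ; ue = uf ; uf = ue
  ; cut-A    = cut-B
  ; cut-B    = trans (cong (λ x → x + e + f) (+-comm d b)) cut-A
  ; unsafe-A = unsafe-B
  ; unsafe-B = subst (λ x → 3 ≤ x + ue + uf) (+-comm ub ud) unsafe-A
  ; ue≤e     = uf≤f
  ; uf≤f     = ue≤e
  ; corner-Y = corner-Z
  ; corner-Z = corner-W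
  ; corner-W = corner-X
  ; corner-X = corner-Y
  }
  where open CrossingCounts r

-- |δ(Y)| − p, where the subtraction is exact because p ≤ |δ(Y)| by corner-Y.
slack-Y slack-Z slack-W slack-X : ∀ {p} → CrossingCounts p → ℕ
slack-Y {p} r = a + b + e ∸ p where open CrossingCounts r
slack-Z r = slack-Y (rotate r)
slack-W r = slack-Z (rotate r)
slack-X r = slack-W (rotate r)

ShortSidesAtY : ∀ {p} → ℕ → CrossingCounts p → Set
ShortSidesAtY α r = a ≡ α × b ≡ α × ua ≤ 1 × ub ≤ 1 × c ≡ α + 1 × d ≡ α + 1
  where open CrossingCounts r

module _ {p : ℕ} (r : CrossingCounts p) where
  open CrossingCounts r

  cut-Y≡p+slack : a + b + e ≡ p + slack-Y r
  cut-Y≡p+slack = proj₁ (excess {p} {2 ⊓ (ua + ub + ue)} corner-Y)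

  slack-Y≤1⇒unsafe-Y≤slack : slack-Y r ≤ 1 → ua + ub + ue ≤ slack-Y r
  slack-Y≤1⇒unsafe-Y≤slack = 2⊓u≤s≤1⇒u≤s (proj₂ (excess {p} {2 ⊓ (ua + ub + ue)} corner-Y))

module _ {p : ℕ} (r : CrossingCounts p) where
  open CrossingCounts r

  opposite-slacks : slack-Y r + slack-W r + f * 2 ≡ 4
  opposite-slacks = opposite-slack-sum {p} {a} {b} {c} {d} {e} {f} cut-A cut-B
    (cut-Y≡p+slack r) (cut-Y≡p+slack (rotate (rotate r)))

  adjacent-slacks : slack-X r + slack-Y r + p ≡ 2 + a * 2
  adjacent-slacks = adjacent-slack-sum {p} {a} {b} {d} {e} {f} cut-A
    (cut-Y≡p+slack (rotate (rotate (rotate r)))) (cut-Y≡p+slack r)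

  adjacent-not-both-small : slack-X r ≤ 1 → slack-Y r ≤ 1 → ⊥
  adjacent-not-both-small small-X small-Y = m+1+n≰m 2 (≤-trans
    (adjacent-unsafe-sum {ua} {ub} {ud} {ue} {uf} unsafe-A
      (slack-Y≤1⇒unsafe-Y≤slack (rotate (rotate (rotate r))) small-X) (slack-Y≤1⇒unsafe-Y≤slack r small-Y))
    (+-mono-≤ small-X small-Y))

  opposite-not-both-small : slack-Y r ≤ 1 → slack-W r ≤ 1 → ⊥
  opposite-not-both-small small-Y small-W = m+1+n≰m 4 (subst (6 ≤_) opposite-slacks
    (opposite-unsafe-sum {ua} {ub} {uc} {ud} {ue} {uf} unsafe-A unsafe-B
      (slack-Y≤1⇒unsafe-Y≤slack r small-Y) (slack-Y≤1⇒unsafe-Y≤slack (rotate (rotate r)) small-W) uf≤f))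

module _ {p q : ℕ} (p≡2q+1 : p ≡ suc (q * 2)) (r : CrossingCounts p) where
  open CrossingCounts r

  some-corner-small : slack-Y r ≤ 1 ⊎ slack-Z r ≤ 1 ⊎ slack-W r ≤ 1 ⊎ slack-X r ≤ 1
  some-corner-small with slack-Y r ≤? 1 | slack-Z r ≤? 1 | slack-W r ≤? 1 | slack-X r ≤? 1
  ... | yes small-Y | _           | _           | _           = inj₁ small-Y
  ... | no _        | yes small-Z | _           | _           = inj₂ (inj₁ small-Z)
  ... | no _        | no _        | yes small-W | _           = inj₂ (inj₂ (inj₁ small-W))
  ... | no _        | no _        | no _        | yes small-X = inj₂ (inj₂ (inj₂ small-X))
  ... | no large-Y  | no large-Z  | no large-W  | no large-X  =
    ⊥-elim (slack-sum≢4 {q = q} {n = a} p≡2q+1 (adjacent-slacks r) (cong₂ _+_ sX≡2 sY≡2))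
    where
    sY≡2 : slack-Y r ≡ 2
    sY≡2 = proj₁ (both-large {g = f} (≰⇒> large-Y) (≰⇒> large-W) (opposite-slacks r))
    sX≡2 : slack-X r ≡ 2
    sX≡2 = proj₁ (proj₂ (both-large {g = e} (≰⇒> large-Z) (≰⇒> large-X) (opposite-slacks (rotate r))))

  small-corner-slacks : slack-Y r ≤ 1 →
    slack-Y r ≡ 1 × slack-Z r ≡ 2 × slack-W r ≡ 3 × slack-X r ≡ 2 × e ≡ 0 × f ≡ 0
  small-corner-slacks small-Y = sY≡1 , sZ≡2 , proj₁ W-and-f , sX≡2 , e≡0 , proj₂ W-and-f
    where
    large-X : 2 ≤ slack-X r
    large-X = ≰⇒> λ small-X → adjacent-not-both-small r small-X small-Y
    large-Z : 2 ≤ slack-Z r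
    large-Z = ≰⇒> λ small-Z → adjacent-not-both-small (rotate r) small-Y small-Z
    large-W : 2 ≤ slack-W r
    large-W = ≰⇒> (opposite-not-both-small r small-Y)
    X-and-Z : slack-Z r ≡ 2 × slack-X r ≡ 2 × e ≡ 0
    X-and-Z = both-large {g = e} large-Z large-X (opposite-slacks (rotate r))
    sZ≡2 : slack-Z r ≡ 2
    sZ≡2 = proj₁ X-and-Z
    sX≡2 : slack-X r ≡ 2
    sX≡2 = proj₁ (proj₂ X-and-Z)
    e≡0 : e ≡ 0
    e≡0 = proj₂ (proj₂ X-and-Z)
    sY≡1 : slack-Y r ≡ 1
    sY≡1 with m≤n⇒m<n∨m≡n small-Y
    ... | inj₁ sY<1 =
      ⊥-elim (slack-sum≢2 {q = q} {n = a} p≡2q+1 (adjacent-slacks r) (cong₂ _+_ sX≡2 (n<1⇒n≡0 sY<1)))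
    ... | inj₂ sY≡1 = sY≡1
    W-and-f : slack-W r ≡ 3 × f ≡ 0
    W-and-f = one-and-large {g = f} sY≡1 large-W (opposite-slacks r)

module _ {p q : ℕ} (p≡2q+1 : p ≡ suc (q * 2)) where

  small-corner-shape : (r : CrossingCounts p) → slack-Y r ≤ 1 →
    let open CrossingCounts r in e ≡ 0 × f ≡ 0 × ShortSidesAtY (suc q) r
  small-corner-shape r small-Y
    with sY≡1 , sZ≡2 , sW≡3 , sX≡2 , e≡0 , f≡0 ← small-corner-slacks {q = q} p≡2q+1 r small-Y =
    e≡0 , f≡0 ,
    side-length-3 {n = a} p≡2q+1 (adjacent-slacks r) (cong₂ _+_ sX≡2 sY≡1) ,
    side-length-3 {n = b} p≡2q+1 (adjacent-slacks (rotate r)) (cong₂ _+_ sY≡1 sZ≡2) ,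
    ≤-trans (≤-trans (m≤m+n ua ub) (m≤m+n (ua + ub) ue)) uY≤1 ,
    ≤-trans (≤-trans (m≤n+m ub ua) (m≤m+n (ua + ub) ue)) uY≤1 ,
    side-length-5 {q = q} {n = c} p≡2q+1 (adjacent-slacks (rotate (rotate r))) (cong₂ _+_ sZ≡2 sW≡3) ,
    side-length-5 {q = q} {n = d} p≡2q+1 (adjacent-slacks (rotate (rotate (rotate r)))) (cong₂ _+_ sW≡3 sX≡2)
    where
    open CrossingCounts r
    uY≤1 : ua + ub + ue ≤ 1
    uY≤1 = ≤-trans (slack-Y≤1⇒unsafe-Y≤slack r small-Y) small-Y

  crossing-shape : (r : CrossingCounts p) → let open CrossingCounts r in
    e ≡ 0 × f ≡ 0 ×
    (ShortSidesAtY (suc q) r ⊎ ShortSidesAtY (suc q) (rotate r) ⊎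
     ShortSidesAtY (suc q) (rotate (rotate r)) ⊎ ShortSidesAtY (suc q) (rotate (rotate (rotate r))))
  crossing-shape r with some-corner-small {q = q} p≡2q+1 r
  ... | inj₁ small-Y =
    let e≡0 , f≡0 , short = small-corner-shape r small-Y
    in  e≡0 , f≡0 , inj₁ short
  ... | inj₂ (inj₁ small-Z) =
    let f≡0 , e≡0 , short = small-corner-shape (rotate r) small-Z
    in  e≡0 , f≡0 , inj₂ (inj₁ short)
  ... | inj₂ (inj₂ (inj₁ small-W)) =
    let e≡0 , f≡0 , short = small-corner-shape (rotate (rotate r)) small-W
    in  e≡0 , f≡0 , inj₂ (inj₂ (inj₁ short))
  ... | inj₂ (inj₂ (inj₂ small-X)) =
    let f≡0 , e≡0 , short = small-corner-shape (rotate (rotate (rotate r))) small-X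
    in  e≡0 , f≡0 , inj₂ (inj₂ (inj₂ short))

x∧¬y⇒¬[x∧y] : ∀ x y → T (x ∧ not y) → T (not (x ∧ y))
x∧¬y⇒¬[x∧y] true false _ = tt

x∧y⇒¬[x∧¬y] : ∀ x y → T (x ∧ y) → T (not (x ∧ not y))
x∧y⇒¬[x∧¬y] true true _ = tt

x∧y⇒¬[y∧¬x] : ∀ x y → T (x ∧ y) → T (not (y ∧ not x))
x∧y⇒¬[y∧¬x] true true _ = tt

x∧y⇒¬¬[x∨y] : ∀ x y → T (x ∧ y) → T (not (not (x ∨ y)))
x∧y⇒¬¬[x∨y] true true _ = tt

crossing-counts : ∀ {p} G → FlexConnected p G → (A B : VSet G) →
  Violated p G A → Violated p G B → Cross G A B → CrossingCounts p
crossing-counts {p} G flex A B (|δA| , 𝒰δA) (|δB| , 𝒰δB)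
                ((x , x∈X) , (y , y∈Y) , (z , z∈Z) , (w , w∈W)) = record
  { a = count (Eb G X Y) ; b = count (Eb G Y Z) ; c = count (Eb G Z W) ; d = count (Eb G W X)
  ; e = count (Eb G Y W) ; f = count (Eb G X Z)
  ; ua = count (Eb G X Y ∩ₑ 𝒰 G) ; ub = count (Eb G Y Z ∩ₑ 𝒰 G) ; uc = count (Eb G Z W ∩ₑ 𝒰 G)
  ; ud = count (Eb G W X ∩ₑ 𝒰 G) ; ue = count (Eb G Y W ∩ₑ 𝒰 G) ; uf = count (Eb G X Z ∩ₑ 𝒰 G)
  ; cut-A    = trans (sym (count-split₄ (δ-split-A G A B))) |δA|
  ; cut-B    = trans (sym (count-split₄ (δ-split-B G A B))) |δB|
  ; unsafe-A = subst (3 ≤_) (count-split₄-∩ (δ-split-A G A B) (𝒰 G)) 𝒰δA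
  ; unsafe-B = subst (3 ≤_) (count-split₄-∩ (δ-split-B G A B) (𝒰 G)) 𝒰δB
  ; ue≤e     = count-∩-≤ (Eb G Y W) (𝒰 G)
  ; uf≤f     = count-∩-≤ (Eb G X Z) (𝒰 G)
  ; corner-Y = corner Y (δ-split-Y G A B) (y , y∈Y) (x , x∧¬y⇒¬[x∧y] (A x) (B x) x∈X)
  ; corner-Z = corner Z (δ-split-Z G A B) (z , z∈Z) (y , x∧y⇒¬[y∧¬x] (A y) (B y) y∈Y)
  ; corner-W = corner W (δ-split-W G A B) (w , w∈W) (y , x∧y⇒¬¬[x∨y] (A y) (B y) y∈Y)
  ; corner-X = corner X (δ-split-X G A B) (x , x∈X) (y , x∧y⇒¬[x∧¬y] (A y) (B y) y∈Y)
  }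
  where
  open Regions G A B
  corner : ∀ S {Q R U : ESet G} → (∀ i → ⟦ δ G S i ⟧ ≡ ⟦ Q i ⟧ + ⟦ R i ⟧ + ⟦ U i ⟧) →
    Nonempty {G} S → Nonempty {G} (compl S) →
    p + 2 ⊓ (count (Q ∩ₑ 𝒰 G) + count (R ∩ₑ 𝒰 G) + count (U ∩ₑ 𝒰 G)) ≤ count Q + count R + count U
  corner S split nonempty nonempty-compl = subst₂ (λ u c → p + 2 ⊓ u ≤ c)
    (count-split₃-∩ split (𝒰 G)) (count-split₃ split)
    (cut-lower-bound flex S nonempty nonempty-compl)

m%2≡1⇒m≡1+[m/2]*2 : ∀ {m} → m % 2 ≡ 1 → m ≡ suc (m / 2 * 2)
m%2≡1⇒m≡1+[m/2]*2 {m} m-odd = trans (m≡m%n+[m/n]*n m 2) (cong (_+ m / 2 * 2) m-odd)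

m%2≡1⇒[m+1]/2≡1+m/2 : ∀ {m} → m % 2 ≡ 1 → (m + 1) / 2 ≡ suc (m / 2)
m%2≡1⇒[m+1]/2≡1+m/2 {m} m-odd = trans (cong (_/ 2) m+1≡) (m*n/n≡m (suc (m / 2)) 2)
  where
  m+1≡ : m + 1 ≡ suc (m / 2) * 2
  m+1≡ = trans (cong (_+ 1) (m%2≡1⇒m≡1+[m/2]*2 m-odd)) (cong suc (+-comm (m / 2 * 2) 1))

lemma1 : (p : ℕ) → 3 ≤ p → p % 2 ≡ 1 →
    (G : Graph) → FlexConnected p G →
    (A B : VSet G) → Violated p G A → Violated p G B → Cross G A B →
    Empty G (Eb G (A ∩ᵥ B) (compl (A ∪ᵥ B))) ×
    Empty G (Eb G (A ∖ᵥ B) (B ∖ᵥ A)) ×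
    (Pattern G ((p + 1) / 2)
        (Eb G (A ∖ᵥ B) (A ∩ᵥ B))
        (Eb G (A ∩ᵥ B) (B ∖ᵥ A))
        (Eb G (B ∖ᵥ A) (compl (A ∪ᵥ B)))
        (Eb G (compl (A ∪ᵥ B)) (A ∖ᵥ B))
     ⊎ Pattern G ((p + 1) / 2)
        (Eb G (A ∩ᵥ B) (B ∖ᵥ A))
        (Eb G (B ∖ᵥ A) (compl (A ∪ᵥ B)))
        (Eb G (compl (A ∪ᵥ B)) (A ∖ᵥ B))
        (Eb G (A ∖ᵥ B) (A ∩ᵥ B))
     ⊎ Pattern G ((p + 1) / 2)
        (Eb G (B ∖ᵥ A) (compl (A ∪ᵥ B)))
        (Eb G (compl (A ∪ᵥ B)) (A ∖ᵥ B))
        (Eb G (A ∖ᵥ B) (A ∩ᵥ B))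
        (Eb G (A ∩ᵥ B) (B ∖ᵥ A))
     ⊎ Pattern G ((p + 1) / 2)
        (Eb G (compl (A ∪ᵥ B)) (A ∖ᵥ B))
        (Eb G (A ∖ᵥ B) (A ∩ᵥ B))
        (Eb G (A ∩ᵥ B) (B ∖ᵥ A))
        (Eb G (B ∖ᵥ A) (compl (A ∪ᵥ B))))
lemma1 p _ p-odd G flex A B violated-A violated-B cross
  with (p + 1) / 2 | m%2≡1⇒[m+1]/2≡1+m/2 {p} p-odd
... | _ | refl
  with e≡0 , f≡0 , short ← crossing-shape (m%2≡1⇒m≡1+[m/2]*2 p-odd)
                              (crossing-counts G flex A B violated-A violated-B cross)
  = count≡0⇒¬T _ e≡0 , count≡0⇒¬T _ f≡0 , short
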